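{- Let $T$ be a string with $\mathsf{e}(T) \geq 3$ and let $a$ be a character. Define $F(T) = \sum_{u \in \mathsf{M}(aT) \setminus \mathsf{M}(T)} d_{aT}(u)$, the total out-degree of the nodes of $\mathrm{CDAWG}(aT)$ that are not nodes of $\mathrm{CDAWG}(T)$. Then $F(T) \leq \mathsf{e}(T) - 1$.
   Context: Strings are finite sequences of characters from an alphabet $\Sigma$; $\varepsilon$ is the empty string. For a string $T$, $\mathrm{Substr}(T)$ is its set of substrings (including $\varepsilon$). A substring $u$ of $T$ is left-maximal in $T$ if $u$ is a prefix of $T$ or there are distinct characters $c \neq d$ with $cu, du \in \mathrm{Substr}(T)$; it is right-maximal in $T$ if $u$ is a suffix of $T$ or there are distinct characters $c\neq d$ with $uc, ud \in \mathrm{Substr}(T)$. $\mathsf{M}(T)$ is the set of substrings of $T$ that are both left- and right-maximal (it contains $\varepsilon$ and $T$). The compact directed acyclic word graph $\mathrm{CDAWG}(T)$ has exactly one node for each element of $\mathsf{M}(T)$, and the outgoing edges of the node $x$ are in bijection with the characters $c$ such that $xc \in \mathrm{Substr}(T)$. For a string $w$, $d_T(w)$ is the number of distinct characters $c$ with $wc \in \mathrm{Substr}(T)$. The size of the CDAWG is $\mathsf{e}(T) = \sum_{x \in \mathsf{M}(T)} d_T(x)$, its number of edges. -}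

module Defs where

open import Data.Nat using (ℕ)
open import Data.Product using (Σ; ∃; ∃₂; _×_; _,_; proj₁; proj₂)
open import Data.Nat.ListAction using (sum)
open import Data.Sum using (_⊎_; inj₁; inj₂)
open import Data.List using (List; []; _∷_; _++_; [_]; length; filter; deduplicate; map; concatMap; inits; tails)
open import Data.List.Properties using (≡-dec)
open import Data.List.Relation.Unary.Any using (Any; here; there; any?)
open import Data.List.Membership.Propositional using (_∈_; find; lose)
open import Data.List.Relation.Binary.Infix.Heterogeneous using (Infix; here; there)
open import Data.List.Relation.Binary.Infix.Heterogeneous.Properties using (infix?)
open import Data.List.Relation.Binary.Prefix.Heterogeneous using (Prefix; _∷_)
open import Data.List.Relation.Binary.Prefix.Heterogeneous.Properties using (prefix?)
open import Data.List.Relation.Binary.Suffix.Heterogeneous using (Suffix)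
open import Data.List.Relation.Binary.Suffix.Heterogeneous.Properties using (suffix?)
open import Relation.Binary.PropositionalEquality using (_≡_; _≢_; refl)
open import Relation.Binary.Definitions using (DecidableEquality)
open import Relation.Nullary using (Dec; yes; no; ¬_; ¬?)
open import Relation.Nullary.Decidable using (_×-dec_; _⊎-dec_; map′)

module Strings {A : Set} (_≟_ : DecidableEquality A) where

  Substr : List A → List A → Set
  Substr u T = Infix _≡_ u T

  IsPrefix IsSuffix : List A → List A → Set
  IsPrefix u T = Prefix _≡_ u T
  IsSuffix u T = Suffix _≡_ u T

  LeftMax : List A → List A → Set
  LeftMax T u = IsPrefix u T
              ⊎ (∃₂ λ c d → c ≢ d × Substr (c ∷ u) T × Substr (d ∷ u) T)

  RightMax : List A → List A → Set
  RightMax T u = IsSuffix u T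
               ⊎ (∃₂ λ c d → c ≢ d × Substr (u ++ [ c ]) T × Substr (u ++ [ d ]) T)

  InM : List A → List A → Set
  InM T u = Substr u T × LeftMax T u × RightMax T u

  substr? : ∀ u T → Dec (Substr u T)
  substr? = infix? _≟_

  private
    head∈ : ∀ {c u T} → Substr (c ∷ u) T → c ∈ T
    head∈ (here (refl ∷ _)) = here refl
    head∈ (there i) = there (head∈ i)

    last∈ : ∀ u {c T} → Substr (u ++ [ c ]) T → c ∈ T
    last∈ [] i = head∈ i
    last∈ (x ∷ u) (here (_ ∷ p)) = there (last∈ u (here p))
    last∈ (x ∷ u) (there i) = there (last∈ (x ∷ u) i)

    pair? : (T : List A) (P : A → Set) → (∀ c → Dec (P c)) → (∀ {c} → P c → c ∈ T) →
            Dec (∃₂ λ c d → c ≢ d × P c × P d)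
    pair? T P P? inT with any? (λ c → any? (λ d → ¬? (c ≟ d) ×-dec (P? c ×-dec P? d)) T) T
    ... | yes a with find a
    ...   | c , _ , b with find b
    ...     | d , _ , (c≢d , pc , pd) = yes (c , d , c≢d , pc , pd)
    pair? T P P? inT | no ¬a =
      no λ { (c , d , c≢d , pc , pd) →
        ¬a (lose (inT pc) (lose (inT pd) (c≢d , pc , pd))) }

  leftMax? : ∀ T u → Dec (LeftMax T u)
  leftMax? T u = prefix? _≟_ u T ⊎-dec
    pair? T (λ c → Substr (c ∷ u) T) (λ c → substr? (c ∷ u) T) head∈

  rightMax? : ∀ T u → Dec (RightMax T u)
  rightMax? T u = suffix? _≟_ u T ⊎-dec
    pair? T (λ c → Substr (u ++ [ c ]) T) (λ c → substr? (u ++ [ c ]) T) (last∈ u)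

  inM? : ∀ T u → Dec (InM T u)
  inM? T u = substr? u T ×-dec (leftMax? T u ×-dec rightMax? T u)

  chars : List A → List A
  chars T = deduplicate _≟_ T

  substrings : List A → List (List A)
  substrings T = deduplicate (≡-dec _≟_) (concatMap inits (tails T))

  Mlist : List A → List (List A)
  Mlist T = filter (inM? T) (substrings T)

  -- d_T(w) = #{ c | w c ∈ Substr(T) }  (such c necessarily occur in T)
  d : List A → List A → ℕ
  d T w = length (filter (λ c → substr? (w ++ [ c ]) T) (chars T))

  e : List A → ℕ
  e T = sum (map (d T) (Mlist T))

  F : A → List A → ℕ
  F a T = sum (map (d (a ∷ T))
                   (filter (λ u → ¬? (inM? T u)) (Mlist (a ∷ T))))

-- A node u of CDAWG(aT) that is not a node of CDAWG(T) is either aT itself, of out-degree 0,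
-- or u = aw where w is a prefix of T and aw occurs in T; then w ∈ M(T) and every right
-- extension of aw in aT is one of w in T, so d_aT(aw) ≤ d_T(w). Charging u to w gives
-- F(T) ≤ e(T). For the missing 1 we find a node y of T with d_T(y) > 0 whose new node ay,
-- if there is one, has strictly smaller degree. Usually y = ε works: either [a] is not new,
-- or some letter z of T has az ∉ Substr(aT). Otherwise aa does not occur in T (it would
-- make [a] a node of T), so T = ac… and every letter of T is a or c; thus d_T(ε) ≤ 2, and
-- e(T) ≥ 3 yields a node y ≠ ε of positive degree, for which ay would contain aa.
module Submission where

open import Algebra.Properties.CommutativeSemigroup using (x∙yz≈y∙xz)
open import Data.List using (List; []; _∷_; _++_; [_]; length; filter; map; concatMap; inits; tails)
open import Data.List.Membership.Propositional using (_∈_; _∉_; find; lose)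
open import Data.List.Membership.Propositional.Properties
  using (∈-filter⁺; ∈-filter⁻; ∈-concatMap⁺; ∈-map⁺; ∈-deduplicate⁺)
import Data.List.Membership.DecPropositional as DecMembership
open import Data.List.Properties using (≡-dec; length-++)
open import Data.List.Relation.Binary.Infix.Heterogeneous using (here; there)
open import Data.List.Relation.Binary.Infix.Heterogeneous.Properties as Infixₚ using (∷⁻)
open import Data.List.Relation.Binary.Pointwise using ([]; _∷_; ≡⇒Pointwise-≡; Pointwise-≡⇒≡)
open import Data.List.Relation.Binary.Prefix.Heterogeneous as Prefix using ([]; _∷_)
import Data.List.Relation.Binary.Prefix.Heterogeneous.Properties as Prefixₚ
open import Data.List.Relation.Binary.Suffix.Heterogeneous as Suffix using (here; there)
open import Data.List.Relation.Unary.All as All using (All)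
open import Data.List.Relation.Unary.AllPairs using (_∷_)
open import Data.List.Relation.Unary.Any using (Any; here; there; any?)
open import Data.List.Relation.Unary.Unique.Propositional using (Unique)
import Data.List.Relation.Unary.Unique.DecPropositional.Properties as DecUnique
import Data.List.Relation.Unary.Unique.Propositional.Properties as Uniqueₚ
open import Data.Nat using (ℕ; suc; _+_; _≤_; _<_; _∸_; z≤n; _<?_)
open import Data.Nat.ListAction using (sum)
open import Data.Nat.Properties
  using ( ≤-refl; ≤-trans; <-irrefl; ≮⇒≥; n≤0⇒n≡0; m≤m+n; m+1+n≰m; +-identityʳ; +-mono-≤; +-mono-<-≤; +-mono-≤-<
        ; ∸-monoˡ-≤; +-commutativeSemigroup; module ≤-Reasoning)
open import Data.Product as Product using (∃; _×_; _,_; proj₁; proj₂)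
open import Data.Sum using (_⊎_; inj₁; inj₂)
open import Function.Base using (case_of_)
open import Relation.Binary.Definitions using (DecidableEquality)
open import Relation.Binary.PropositionalEquality using (_≡_; _≢_; refl; sym; trans; cong; subst; subst₂; ≢-sym; module ≡-Reasoning)
open import Relation.Nullary using (yes; no; ¬_; ¬?; contradiction)
open import Relation.Nullary.Decidable using (_×-dec_; decidable-stable)

open import Defs

module WeightedSum {B C : Set} (_≟_ : DecidableEquality C) (emb : C → B) (g : B → ℕ) (h : C → ℕ) where

  remove : C → List C → List C
  remove w [] = []
  remove w (y ∷ ys) with w ≟ y
  ... | yes _ = ys
  ... | no  _ = y ∷ remove w ys

  sum-remove : ∀ {w} ys → w ∈ ys → sum (map h ys) ≡ h w + sum (map h (remove w ys))
  sum-remove {w} (y ∷ ys) w∈ with w ≟ y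
  ... | yes refl = refl
  sum-remove {w} (y ∷ ys) (here refl)  | no w≢y = contradiction refl w≢y
  sum-remove {w} (y ∷ ys) (there w∈ys) | no w≢y = begin
    h y + sum (map h ys)                     ≡⟨ cong (h y +_) (sum-remove ys w∈ys) ⟩
    h y + (h w + sum (map h (remove w ys)))  ≡⟨ x∙yz≈y∙xz +-commutativeSemigroup (h y) (h w) _ ⟩
    h w + (h y + sum (map h (remove w ys)))  ∎
    where open ≡-Reasoning

  ∈-remove : ∀ {w y} ys → y ∈ ys → y ≢ w → y ∈ remove w ys
  ∈-remove {w} (z ∷ ys) y∈ y≢w with w ≟ z
  ∈-remove (z ∷ ys) (here refl)  y≢w | yes refl = contradiction refl y≢w
  ∈-remove (z ∷ ys) (there y∈ys) y≢w | yes refl = y∈ys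
  ∈-remove (z ∷ ys) (here refl)  y≢w | no _     = here refl
  ∈-remove (z ∷ ys) (there y∈ys) y≢w | no _     = there (∈-remove ys y∈ys y≢w)

  Dominated : List B → List C → Set
  Dominated N Y = ∀ {u} → u ∈ N → g u ≡ 0 ⊎ ∃ λ w → u ≡ emb w × w ∈ Y × g u ≤ h w

  dominated-remove : ∀ {u N Y w} → All (u ≢_) N → u ≡ emb w →
                     Dominated (u ∷ N) Y → Dominated N (remove w Y)
  dominated-remove {Y = Y} u∉N u≡emb-w dom u′∈N with dom (there u′∈N)
  ... | inj₁ g≡0 = inj₁ g≡0
  ... | inj₂ (w′ , u′≡emb-w′ , w′∈Y , g≤h) =
    inj₂ (w′ , u′≡emb-w′ , ∈-remove Y w′∈Y w′≢w , g≤h)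
    where
      w′≢w : _ ≢ _
      w′≢w refl = All.lookup u∉N u′∈N (trans u≡emb-w (sym u′≡emb-w′))

  -- emb need not be injective: u ≡ emb w determines u, so distinct elements of N are charged to distinct w.
  sum-≤ : ∀ {N} Y → Unique N → Dominated N Y → sum (map g N) ≤ sum (map h Y)
  sum-≤ {[]} Y _ _ = z≤n
  sum-≤ {u ∷ N} Y (u∉N ∷ uniq) dom with dom (here refl)
  ... | inj₁ g≡0 rewrite g≡0 = sum-≤ Y uniq (λ m → dom (there m))
  ... | inj₂ (w , u≡emb-w , w∈Y , g≤h) = begin
    g u + sum (map g N)                  ≤⟨ +-mono-≤ g≤h (sum-≤ (remove w Y) uniq (dominated-remove u∉N u≡emb-w dom)) ⟩
    h w + sum (map h (remove w Y))       ≡⟨ sum-remove Y w∈Y ⟨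
    sum (map h Y)                        ∎
    where open ≤-Reasoning

  sum-< : ∀ {N} Y → Unique N → Dominated N Y → ∀ {y} → y ∈ Y → 0 < h y →
          (emb y ∈ N → g (emb y) < h y) → sum (map g N) < sum (map h Y)
  sum-< {[]} Y _ _ {y} y∈Y 0<h _ = begin-strict
    0                              <⟨ 0<h ⟩
    h y                            ≤⟨ m≤m+n (h y) _ ⟩
    h y + sum (map h (remove y Y)) ≡⟨ sum-remove Y y∈Y ⟨
    sum (map h Y)                  ∎
    where open ≤-Reasoning
  sum-< {u ∷ N} Y (u∉N ∷ uniq) dom {y} y∈Y 0<h g<h with dom (here refl)
  ... | inj₁ g≡0 rewrite g≡0 = sum-< Y uniq (λ m → dom (there m)) y∈Y 0<h (λ m → g<h (there m))
  ... | inj₂ (w , refl , w∈Y , g≤h) = begin-strict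
    g (emb w) + sum (map g N)      <⟨ bound ⟩
    h w + sum (map h (remove w Y)) ≡⟨ sum-remove Y w∈Y ⟨
    sum (map h Y)                  ∎
    where
      open ≤-Reasoning
      dom′ : Dominated N (remove w Y)
      dom′ = dominated-remove u∉N refl dom
      bound : g (emb w) + sum (map g N) < h w + sum (map h (remove w Y))
      bound with w ≟ y
      ... | yes refl = +-mono-<-≤ (g<h (here refl)) (sum-≤ (remove w Y) uniq dom′)
      ... | no w≢y = +-mono-≤-< g≤h
        (sum-< (remove w Y) uniq dom′ (∈-remove Y y∈Y (≢-sym w≢y)) 0<h (λ m → g<h (there m)))

length≡sum-ones : ∀ {X : Set} (xs : List X) → length xs ≡ sum (map (λ _ → 1) xs)
length≡sum-ones [] = refl
length≡sum-ones (x ∷ xs) = cong suc (length≡sum-ones xs)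

module Counting {X : Set} (_≟_ : DecidableEquality X) where
  open WeightedSum _≟_ (λ x → x) (λ _ → 1) (λ _ → 1)

  Unique-⊆⇒length≤ : ∀ {xs ys} → Unique xs → (∀ {x} → x ∈ xs → x ∈ ys) → length xs ≤ length ys
  Unique-⊆⇒length≤ {xs} {ys} uniq xs⊆ys =
    subst₂ _≤_ (sym (length≡sum-ones xs)) (sym (length≡sum-ones ys))
      (sum-≤ ys uniq (λ x∈xs → inj₂ (_ , refl , xs⊆ys x∈xs , ≤-refl)))

  Unique-⊆⇒length< : ∀ {xs ys y} → Unique xs → (∀ {x} → x ∈ xs → x ∈ ys) → y ∈ ys → y ∉ xs →
                     length xs < length ys
  Unique-⊆⇒length< {xs} {ys} uniq xs⊆ys y∈ys y∉xs =
    subst₂ _<_ (sym (length≡sum-ones xs)) (sym (length≡sum-ones ys))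
      (sum-< ys uniq (λ x∈xs → inj₂ (_ , refl , xs⊆ys x∈xs , ≤-refl)) y∈ys ≤-refl (λ y∈xs → contradiction y∈xs y∉xs))

module Nodes {A : Set} (_≟_ : DecidableEquality A) where
  open Strings _≟_
  open Counting _≟_

  _≟ₗ_ : DecidableEquality (List A)
  _≟ₗ_ = ≡-dec _≟_

  open DecMembership _≟ₗ_ using (_∈?_)

  prefix-refl : ∀ {T} → IsPrefix T T
  prefix-refl = Prefixₚ.fromPointwise (≡⇒Pointwise-≡ refl)

  prefix-++ : ∀ u {v} → IsPrefix u (u ++ v)
  prefix-++ u {v} = Prefix.fromView (≡⇒Pointwise-≡ refl Prefix.++ v)

  suffix-ε : ∀ T → IsSuffix [] T
  suffix-ε []      = here []
  suffix-ε (x ∷ T) = there (suffix-ε T)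

  substr-++ˡ : ∀ u {v T} → Substr (u ++ v) T → Substr u T
  substr-++ˡ u = Infixₚ.Prefix-Infix-trans trans (prefix-++ u)

  substr-tail : ∀ {x v T} → Substr (x ∷ v) T → Substr v T
  substr-tail = Infixₚ.Suffix-Infix-trans trans (there (here (≡⇒Pointwise-≡ refl)))

  substr-∷-tail : ∀ {x v a T} → Substr (x ∷ v) (a ∷ T) → Substr v T
  substr-∷-tail s with ∷⁻ s
  ... | inj₁ (_ ∷ p) = here p
  ... | inj₂ s′      = substr-tail s′

  ∈⇒substr : ∀ {c T} → c ∈ T → Substr [ c ] T
  ∈⇒substr (here refl)  = here (refl ∷ [])
  ∈⇒substr (there c∈T) = there (∈⇒substr c∈T)

  substr⇒∈ : ∀ u {c T} → Substr (u ++ [ c ]) T → c ∈ T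
  substr⇒∈ []      (here (refl ∷ [])) = here refl
  substr⇒∈ []      (there s)          = there (substr⇒∈ [] s)
  substr⇒∈ (x ∷ u) s                  = substr⇒∈ u (substr-tail s)

  prefix-last : ∀ u {c d X} → IsPrefix (u ++ [ c ]) X → IsPrefix (u ++ [ d ]) X → c ≡ d
  prefix-last []      (refl ∷ _) (refl ∷ _) = refl
  prefix-last (x ∷ u) (_ ∷ p)    (_ ∷ q)    = prefix-last u p q

  ε-InM : ∀ T → InM T []
  ε-InM T = here [] , inj₁ [] , inj₁ (suffix-ε T)

  prefix⇒∈inits : ∀ {u T} → IsPrefix u T → u ∈ inits T
  prefix⇒∈inits []                     = here refl
  prefix⇒∈inits {x ∷ u} {x ∷ T} (refl ∷ p) = there (∈-map⁺ (x ∷_) (prefix⇒∈inits p))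

  substr⇒∈substrings : ∀ {u T} → Substr u T → u ∈ substrings T
  substr⇒∈substrings s = ∈-deduplicate⁺ _≟ₗ_ (∈-concatMap⁺ inits (occurrence s))
    where
      occurrence : ∀ {u T} → Substr u T → Any (λ t → u ∈ inits t) (tails T)
      occurrence (here p)  = here (prefix⇒∈inits p)
      occurrence (there s) = there (occurrence s)

  InM⇒∈Mlist : ∀ {T u} → InM T u → u ∈ Mlist T
  InM⇒∈Mlist {T} m = ∈-filter⁺ (inM? T) (substr⇒∈substrings (proj₁ m)) m

  ∈Mlist⇒InM : ∀ {T u} → u ∈ Mlist T → InM T u
  ∈Mlist⇒InM {T} m = proj₂ (∈-filter⁻ (inM? T) {xs = substrings T} m)

  Mlist-unique : ∀ T → Unique (Mlist T)
  Mlist-unique T = Uniqueₚ.filter⁺ (inM? T) {xs = substrings T} (DecUnique.deduplicate-! _≟ₗ_ (concatMap inits (tails T)))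

  next : List A → List A → List A
  next T w = filter (λ c → substr? (w ++ [ c ]) T) (chars T)

  ∈next⁺ : ∀ {T w c} → Substr (w ++ [ c ]) T → c ∈ next T w
  ∈next⁺ {T} {w} s = ∈-filter⁺ (λ c → substr? (w ++ [ c ]) T) (∈-deduplicate⁺ _≟_ (substr⇒∈ w s)) s

  ∈next⁻ : ∀ {T w c} → c ∈ next T w → Substr (w ++ [ c ]) T
  ∈next⁻ {T} {w} m = proj₂ (∈-filter⁻ (λ c → substr? (w ++ [ c ]) T) {xs = chars T} m)

  next-unique : ∀ T w → Unique (next T w)
  next-unique T w = Uniqueₚ.filter⁺ (λ c → substr? (w ++ [ c ]) T) {xs = chars T} (DecUnique.deduplicate-! _≟_ T)

  d-mono : ∀ {X w Y v} → (∀ {c} → Substr (w ++ [ c ]) X → Substr (v ++ [ c ]) Y) → d X w ≤ d Y v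
  d-mono {X} {w} ext = Unique-⊆⇒length≤ (next-unique X w) (λ m → ∈next⁺ (ext (∈next⁻ m)))

  d-mono-< : ∀ {X w Y v c} → (∀ {c} → Substr (w ++ [ c ]) X → Substr (v ++ [ c ]) Y) →
             Substr (v ++ [ c ]) Y → ¬ Substr (w ++ [ c ]) X → d X w < d Y v
  d-mono-< {X} {w} ext s ¬s =
    Unique-⊆⇒length< (next-unique X w) (λ m → ∈next⁺ (ext (∈next⁻ m))) (∈next⁺ s) (λ m → ¬s (∈next⁻ m))

  d-pos : ∀ {T w c} → Substr (w ++ [ c ]) T → 0 < d T w
  d-pos s = d-mono-< {X = []} {w = []} (λ { (here ()) }) s (λ { (here ()) })

  d-self : ∀ T → d T T ≡ 0
  d-self T = n≤0⇒n≡0 (d-mono {Y = []} {v = []} too-long)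
    where
      too-long : ∀ {c} → Substr (T ++ [ c ]) T → Substr [ c ] []
      too-long s = contradiction (subst (_≤ length T) (length-++ T) (Infixₚ.length-mono s)) (m+1+n≰m (length T))

  leftMax-∷ : ∀ {a T u} → LeftMax (a ∷ T) u → IsPrefix u (a ∷ T) ⊎ LeftMax T u
  leftMax-∷ (inj₁ p) = inj₁ p
  leftMax-∷ (inj₂ (c , d , c≢d , cu⊑aT , du⊑aT)) with ∷⁻ cu⊑aT | ∷⁻ du⊑aT
  ... | inj₁ (refl ∷ p) | _              = inj₂ (inj₁ p)
  ... | inj₂ _          | inj₁ (refl ∷ p) = inj₂ (inj₁ p)
  ... | inj₂ cu⊑T       | inj₂ du⊑T       = inj₂ (inj₂ (c , d , c≢d , cu⊑T , du⊑T))

  rightMax-∷ : ∀ {a T u} → RightMax (a ∷ T) u → IsPrefix u (a ∷ T) ⊎ RightMax T u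
  rightMax-∷ (inj₁ (here pw)) with Pointwise-≡⇒≡ pw
  ... | refl = inj₁ prefix-refl
  rightMax-∷ (inj₁ (there s)) = inj₂ (inj₁ s)
  rightMax-∷ {u = u} (inj₂ (c , d , c≢d , uc⊑aT , ud⊑aT)) with ∷⁻ uc⊑aT | ∷⁻ ud⊑aT
  ... | inj₁ p    | _         = inj₁ (Prefixₚ.trans trans (prefix-++ u) p)
  ... | inj₂ _    | inj₁ p    = inj₁ (Prefixₚ.trans trans (prefix-++ u) p)
  ... | inj₂ uc⊑T | inj₂ ud⊑T = inj₂ (inj₂ (c , d , c≢d , uc⊑T , ud⊑T))

  rightMax-∷-tail : ∀ {a T w} → RightMax (a ∷ T) (a ∷ w) → RightMax T w
  rightMax-∷-tail (inj₁ (here (_ ∷ pw))) = inj₁ (here pw)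
  rightMax-∷-tail (inj₁ (there s))       = inj₁ (Suffix.tail s)
  rightMax-∷-tail (inj₂ (c , d , c≢d , s₁ , s₂)) = inj₂ (c , d , c≢d , substr-∷-tail s₁ , substr-∷-tail s₂)

  InM-∷-absent : ∀ {a T u} → InM (a ∷ T) u → ¬ Substr u T → u ≡ a ∷ T
  InM-∷-absent {a} {T} (u⊑aT , _ , rm) u⋢T with ∷⁻ u⊑aT
  ... | inj₂ u⊑T = contradiction u⊑T u⋢T
  ... | inj₁ []  = contradiction (here []) u⋢T
  ... | inj₁ (refl ∷ w⊑T) with rm
  ...   | inj₁ (here pw)  = Pointwise-≡⇒≡ pw
  ...   | inj₁ (there s)  = contradiction (Infixₚ.fromSuffix s) u⋢T
  ...   | inj₂ (c , d , c≢d , uc⊑aT , ud⊑aT) with ∷⁻ uc⊑aT | ∷⁻ ud⊑aT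
  ...     | inj₂ uc⊑T | _         = contradiction (substr-++ˡ (a ∷ _) uc⊑T) u⋢T
  ...     | inj₁ _    | inj₂ ud⊑T = contradiction (substr-++ˡ (a ∷ _) ud⊑T) u⋢T
  ...     | inj₁ p    | inj₁ q    = contradiction (prefix-last (a ∷ _) p q) c≢d

  InM-∷-present : ∀ {a T u} → InM (a ∷ T) u → ¬ InM T u → Substr u T → ∃ λ w → u ≡ a ∷ w × IsPrefix w T
  InM-∷-present {a} {T} {u} (_ , lm , rm) u∉M u⊑T = shape prefix
    where
      prefix : IsPrefix u (a ∷ T)
      prefix with leftMax-∷ lm | rightMax-∷ rm
      ... | inj₁ p | _      = p
      ... | inj₂ _ | inj₁ p = p
      ... | inj₂ l | inj₂ r = contradiction (u⊑T , l , r) u∉M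
      shape : IsPrefix u (a ∷ T) → ∃ λ w → u ≡ a ∷ w × IsPrefix w T
      shape []          = contradiction (ε-InM T) u∉M
      shape (refl ∷ p) = _ , refl , p

  NewNodes : A → List A → List (List A)
  NewNodes a T = filter (λ u → ¬? (inM? T u)) (Mlist (a ∷ T))

  NewNodes-unique : ∀ a T → Unique (NewNodes a T)
  NewNodes-unique a T = Uniqueₚ.filter⁺ (λ u → ¬? (inM? T u)) {xs = Mlist (a ∷ T)} (Mlist-unique (a ∷ T))

  ∈NewNodes⁻ : ∀ {a T u} → u ∈ NewNodes a T → InM (a ∷ T) u × ¬ InM T u
  ∈NewNodes⁻ {a} {T} m = Product.map₁ ∈Mlist⇒InM (∈-filter⁻ (λ u → ¬? (inM? T u)) {xs = Mlist (a ∷ T)} m)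

  new-node-shape : ∀ {a T u} → u ∈ NewNodes a T →
                   u ≡ a ∷ T ⊎ ∃ λ w → u ≡ a ∷ w × IsPrefix w T × Substr u T
  new-node-shape {a} {T} {u} m with ∈NewNodes⁻ m | substr? u T
  ... | u∈M , _   | no u⋢T = inj₁ (InM-∷-absent u∈M u⋢T)
  ... | u∈M , u∉M | yes u⊑T with InM-∷-present u∈M u∉M u⊑T
  ...   | w , u≡aw , w⊑T = inj₂ (w , u≡aw , w⊑T , u⊑T)

  new-node-dominated : ∀ {a T u} → u ∈ NewNodes a T →
                       d (a ∷ T) u ≡ 0 ⊎ ∃ λ w → u ≡ a ∷ w × w ∈ Mlist T × d (a ∷ T) u ≤ d T w
  new-node-dominated {a} {T} m with new-node-shape {a} {T} m
  ... | inj₁ refl = inj₁ (d-self (a ∷ T))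
  ... | inj₂ (w , refl , w⊑T , _) =
    inj₂ (w , refl , InM⇒∈Mlist (here w⊑T , inj₁ w⊑T , rightMax-∷-tail (proj₂ (proj₂ (proj₁ (∈NewNodes⁻ m))))) ,
          d-mono {w = a ∷ w} {Y = T} {v = w} substr-∷-tail)

  prefix-or-preceded : ∀ {c T} → Substr [ c ] T → IsPrefix [ c ] T ⊎ ∃ λ b → b ≢ c × Substr (b ∷ c ∷ []) T
  prefix-or-preceded {T = []} (here ())
  prefix-or-preceded {c} {y ∷ T} s with y ≟ c
  ... | yes refl = inj₁ (refl ∷ [])
  ... | no y≢c with ∷⁻ s
  ...   | inj₁ (refl ∷ []) = contradiction refl y≢c
  ...   | inj₂ s′ with prefix-or-preceded s′
  ...     | inj₁ (refl ∷ [])       = inj₂ (y , y≢c , here (refl ∷ refl ∷ []))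
  ...     | inj₂ (b , b≢c , bc⊑T) = inj₂ (b , b≢c , there bc⊑T)

  suffix-or-followed : ∀ {c T} → Substr [ c ] T → IsSuffix [ c ] T ⊎ ∃ λ b → b ≢ c × Substr (c ∷ b ∷ []) T
  suffix-or-followed {T = []} (here ())
  suffix-or-followed {c} {y ∷ T} s with substr? [ c ] T
  ... | yes s′ with suffix-or-followed s′
  ...   | inj₁ suf                = inj₁ (there suf)
  ...   | inj₂ (b , b≢c , cb⊑T) = inj₂ (b , b≢c , there cb⊑T)
  suffix-or-followed {c} {y ∷ T} s | no c⋢T with ∷⁻ s
  ... | inj₂ s′ = contradiction s′ c⋢T
  suffix-or-followed {c} {c ∷ []}    s | no c⋢T | inj₁ (refl ∷ []) = inj₁ (here (refl ∷ []))
  suffix-or-followed {c} {c ∷ b ∷ T} s | no c⋢T | inj₁ (refl ∷ []) =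
    inj₂ (b , (λ { refl → c⋢T (here (refl ∷ [])) }) , here (refl ∷ refl ∷ []))

  square⇒InM : ∀ {c T} → Substr (c ∷ c ∷ []) T → InM T [ c ]
  square⇒InM {c} {T} cc⊑T = c⊑T , left , right
    where
      c⊑T : Substr [ c ] T
      c⊑T = substr-++ˡ [ c ] cc⊑T
      left : LeftMax T [ c ]
      left with prefix-or-preceded c⊑T
      ... | inj₁ p                 = inj₁ p
      ... | inj₂ (b , b≢c , bc⊑T) = inj₂ (b , c , b≢c , bc⊑T , cc⊑T)
      right : RightMax T [ c ]
      right with suffix-or-followed c⊑T
      ... | inj₁ s                 = inj₁ s
      ... | inj₂ (b , b≢c , cb⊑T) = inj₂ (c , b , ≢-sym b≢c , cc⊑T , cb⊑T)

  DegreeDrop : A → List A → Set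
  DegreeDrop a T = ∃ λ y → y ∈ Mlist T × 0 < d T y × (a ∷ y ∈ NewNodes a T → d (a ∷ T) (a ∷ y) < d T y)

  e≤d-ε : ∀ T → (∀ {y} → y ∈ Mlist T → y ≢ [] → d T y ≡ 0) → e T ≤ d T []
  e≤d-ε T zero-elsewhere = subst (e T ≤_) (+-identityʳ (d T [])) (sum-≤ ([] ∷ []) (Mlist-unique T) dominated)
    where
      open WeightedSum _≟ₗ_ (λ y → y) (d T) (d T)
      dominated : Dominated (Mlist T) ([] ∷ [])
      dominated {y} y∈M with y ≟ₗ []
      ... | yes refl = inj₂ ([] , refl , here refl , ≤-refl)
      ... | no y≢[]  = inj₁ (zero-elsewhere y∈M y≢[])

  d-ε≤2 : ∀ {a T} → IsPrefix [ a ] T → ¬ RightMax T [ a ] →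
          (∀ {z} → z ∈ T → Substr (a ∷ z ∷ []) (a ∷ T)) → d T [] ≤ 2
  d-ε≤2 {a} {a ∷ []}    (refl ∷ []) ¬rm _ = contradiction (inj₁ (here (refl ∷ []))) ¬rm
  d-ε≤2 {a} {a ∷ c ∷ T} (refl ∷ []) ¬rm az⊑aT =
    Unique-⊆⇒length≤ (next-unique (a ∷ c ∷ T) []) (λ m → a-or-c (az⊑aT (substr⇒∈ [] (∈next⁻ {w = []} m))))
    where
      a-or-c : ∀ {z} → Substr (a ∷ z ∷ []) (a ∷ a ∷ c ∷ T) → z ∈ a ∷ c ∷ []
      a-or-c {z} s with ∷⁻ s
      ... | inj₁ (refl ∷ refl ∷ []) = here refl
      ... | inj₂ az⊑T with z ≟ c
      ...   | yes refl = there (here refl)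
      ...   | no z≢c   = contradiction (inj₂ (z , c , z≢c , az⊑T , here (refl ∷ refl ∷ []))) ¬rm

  square-free⇒∉NewNodes : ∀ {a T y} → IsPrefix [ a ] T → ¬ Substr (a ∷ a ∷ []) T → y ≢ [] → 0 < d T y →
                          a ∷ y ∉ NewNodes a T
  square-free⇒∉NewNodes {a} {T} {y} a-prefix aa⋢T y≢[] 0<d m with new-node-shape {a} {T} m
  ... | inj₁ refl                    = <-irrefl refl (subst (0 <_) (d-self T) 0<d)
  ... | inj₂ (_ , refl , y⊑T , ay⊑T) = aa⋢T (aa⊑T a-prefix y⊑T y≢[] ay⊑T)
    where
      aa⊑T : ∀ {y} → IsPrefix [ a ] T → IsPrefix y T → y ≢ [] → Substr (a ∷ y) T → Substr (a ∷ a ∷ []) T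
      aa⊑T _           []         y≢[] _    = contradiction refl y≢[]
      aa⊑T (refl ∷ []) (refl ∷ _) _    ay⊑T = substr-++ˡ (a ∷ a ∷ []) ay⊑T

  ¬InM⇒prefix : ∀ {a T} → ¬ InM T [ a ] → Substr (a ∷ a ∷ []) (a ∷ T) → IsPrefix [ a ] T
  ¬InM⇒prefix a∉M aa⊑aT with ∷⁻ aa⊑aT
  ... | inj₁ (_ ∷ a-prefix) = a-prefix
  ... | inj₂ aa⊑T           = contradiction (square⇒InM aa⊑T) a∉M

  ε-degreeDrop : ∀ {a T x} → x ∈ T → ([ a ] ∈ NewNodes a T → d (a ∷ T) [ a ] < d T []) → DegreeDrop a T
  ε-degreeDrop {T = T} x∈T drop = [] , InM⇒∈Mlist (ε-InM T) , d-pos {w = []} (∈⇒substr x∈T) , drop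

  degreeDrop-two-letters : ∀ {a T} → 3 ≤ e T → IsPrefix [ a ] T → ¬ InM T [ a ] →
                           (∀ {z} → z ∈ T → Substr (a ∷ z ∷ []) (a ∷ T)) → DegreeDrop a T
  degreeDrop-two-letters {a} {T} 3≤e a-prefix a∉M az⊑aT =
    case any? (λ y → ¬? (y ≟ₗ []) ×-dec (0 <? d T y)) (Mlist T) of λ where
      (yes found) →
        let y , y∈M , y≢[] , 0<d = find found in
        y , y∈M , 0<d , λ new → contradiction new (square-free⇒∉NewNodes a-prefix (λ aa⊑T → a∉M (square⇒InM aa⊑T)) y≢[] 0<d)
      (no none) →
        let zero-elsewhere : ∀ {y} → y ∈ Mlist T → y ≢ [] → d T y ≡ 0
            zero-elsewhere y∈M y≢[] = n≤0⇒n≡0 (≮⇒≥ λ 0<d → none (lose y∈M (y≢[] , 0<d)))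
        in contradiction (≤-trans 3≤e (≤-trans (e≤d-ε T zero-elsewhere) (d-ε≤2 a-prefix ¬rm az⊑aT))) (<-irrefl refl)
    where
      ¬rm : ¬ RightMax T [ a ]
      ¬rm rm = a∉M (here a-prefix , inj₁ a-prefix , rm)

  degreeDrop-singleton : ∀ {a T} → 3 ≤ e T → Substr [ a ] T → ¬ InM T [ a ] → DegreeDrop a T
  degreeDrop-singleton {a} {T} 3≤e a⊑T a∉M =
    case any? (λ z → ¬? (substr? (a ∷ z ∷ []) (a ∷ T))) T of λ where
      (yes missing) →
        let z , z∈T , az⋢aT = find missing in
        ε-degreeDrop z∈T λ _ → d-mono-< {w = [ a ]} {v = []} substr-∷-tail (∈⇒substr z∈T) az⋢aT
      (no none) →
        let az⊑aT : ∀ {z} → z ∈ T → Substr (a ∷ z ∷ []) (a ∷ T)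
            az⊑aT {z} z∈T = decidable-stable (substr? (a ∷ z ∷ []) (a ∷ T)) λ az⋢aT → none (lose z∈T az⋢aT)
        in degreeDrop-two-letters 3≤e (¬InM⇒prefix a∉M (az⊑aT (substr⇒∈ [] a⊑T))) a∉M az⊑aT

  new-singleton : ∀ {a T x} → x ∈ T → [ a ] ∈ NewNodes a T → Substr [ a ] T × ¬ InM T [ a ]
  new-singleton {a} {T} x∈T new with new-node-shape {a} {T} new
  ... | inj₁ refl              = contradiction x∈T λ ()
  ... | inj₂ (_ , _ , _ , a⊑T) = a⊑T , proj₂ (∈NewNodes⁻ new)

  degreeDrop-occurring : ∀ {a T x} → x ∈ T → 3 ≤ e T → DegreeDrop a T
  degreeDrop-occurring {a} {T} x∈T 3≤e = case [ a ] ∈? NewNodes a T of λ where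
    (no ¬new) → ε-degreeDrop x∈T λ new → contradiction new ¬new
    (yes new) → let a⊑T , a∉M = new-singleton x∈T new in degreeDrop-singleton 3≤e a⊑T a∉M

  degreeDrop : ∀ a T → 3 ≤ e T → DegreeDrop a T
  degreeDrop a []      3≤e = contradiction 3≤e λ ()
  degreeDrop a (x ∷ T) 3≤e = degreeDrop-occurring (here refl) 3≤e

  F<e : ∀ a T → DegreeDrop a T → F a T < e T
  F<e a T (y , y∈M , 0<d , drop) =
    sum-< (Mlist T) (NewNodes-unique a T) new-node-dominated y∈M 0<d drop
    where open WeightedSum _≟ₗ_ (a ∷_) (d (a ∷ T)) (d T)

lemma4 : {A : Set} (_≟_ : DecidableEquality A) (T : List A) (a : A) →
         3 ≤ Strings.e _≟_ T →
         Strings.F _≟_ a T ≤ Strings.e _≟_ T ∸ 1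
lemma4 _≟_ T a 3≤e = ∸-monoˡ-≤ 1 (F<e a T (degreeDrop a T 3≤e))
  where open Nodes _≟_
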